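{- Let $G=(V,E)$ be a directed unweighted graph and let $d>0$ be an integer. Suppose we are given a collection $\mathcal{T}=\{T_v:v\in V\}$ of shortest path trees up to depth $d$ from all vertices of $G$. Let $B$ be a $(\mathcal{T},d)$-blocker set. Then $B$ is a $2d$-hub set of $G$.
   Context: A shortest path tree from $s$ up to depth $d$ is an out-tree $T\subseteq G$ rooted at $s$ such that $v\in V(T)$ iff $\delta_G(s,v)\le d$, and $\delta_T(s,v)=\delta_G(s,v)$ for all $v\in V(T)$ (distances are numbers of edges). For a rooted tree $T$ of depth at most $d$, $B$ is a $(T,d)$-blocker set if for every vertex $v$ of depth exactly $d$ in $T$, $v$ or one of its ancestors is in $B$; $B$ is a $(\mathcal{T},d)$-blocker set if this holds for every $T\in\mathcal{T}$. A path $P$ is $(H,d)$-covered if $P=P_1\cdots P_k$ with $P_i$ a $u_i\to v_i$ path with at most $d$ edges and $u_i\in H$ for $i\ge2$. $H\subseteq V$ is a $d$-hub set of $G$ if for every $u,v$ with $\delta_G(u,v)<\infty$ some shortest $u\to v$ path is $(H,d)$-covered. -}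

module Defs where

open import Data.Nat using (ℕ; zero; suc; _+_; _≤_; _<_)
open import Data.Fin using (Fin)
open import Data.Bool using (Bool; T)
open import Data.Product using (Σ; _×_; _,_; ∃)
open import Function.Bundles using (_⇔_)
open import Relation.Binary.PropositionalEquality using (_≡_; _≢_)

Graph : ℕ → Set
Graph n = Fin n → Fin n → Bool

module _ {n : ℕ} (G : Graph n) where

  Edge : Fin n → Fin n → Set
  Edge u v = T (G u v)

  -- Directed walks u → v in G (a shortest walk is automatically a path).
  data Walk : Fin n → Fin n → Set where
    []   : ∀ {u} → Walk u u
    step : ∀ {u v} (w : Fin n) → Edge u w → Walk w v → Walk u v

  len : ∀ {u v} → Walk u v → ℕ
  len []             = 0
  len (step _ _ p)   = suc (len p)

  _++_ : ∀ {u w v} → Walk u w → Walk w v → Walk u v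
  []             ++ q = q
  (step w e p)   ++ q = step w e (p ++ q)

  DistLe : Fin n → Fin n → ℕ → Set
  DistLe u v k = Σ (Walk u v) λ p → len p ≤ k

  DistEq : Fin n → Fin n → ℕ → Set
  DistEq u v k = (Σ (Walk u v) λ p → len p ≡ k) × (∀ (q : Walk u v) → k ≤ len q)

  IsShortest : ∀ {u v} → Walk u v → Set
  IsShortest {u} {v} p = ∀ (q : Walk u v) → len p ≤ len q

  data Covered (H : Fin n → Set) (D : ℕ) : ∀ {u v} → Walk u v → Set where
    single : ∀ {u v} (p : Walk u v) → len p ≤ D → Covered H D p
    join   : ∀ {u w v} (p₁ : Walk u w) (p₂ : Walk w v) →
             len p₁ ≤ D → H w → Covered H D p₂ → Covered H D (p₁ ++ p₂)

  IsHubSet : (Fin n → Set) → ℕ → Set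
  IsHubSet H D = ∀ (u v : Fin n) → Walk u v →
                 Σ (Walk u v) λ p → IsShortest p × Covered H D p

  iter : (Fin n → Fin n) → ℕ → Fin n → Fin n
  iter f zero x    = x
  iter f (suc j) x = f (iter f j x)

  -- A shortest path tree T from s up to depth d: an out-tree T ⊆ G rooted
  -- at s, given by its vertex set `mem` and the parent map (tree edges are
  -- parent v → v for v ∈ V(T), v ≠ s).  `depth v` is the depth of v in T,
  -- i.e. δ_T(s,v) (number of parent steps to s); the depth equations force
  -- acyclicity and that every tree vertex is reached from s.
  record SPTree (d : ℕ) (s : Fin n) : Set₁ where
    field
      mem          : Fin n → Set
      parent       : Fin n → Fin n
      depth        : Fin n → ℕ
      root-mem     : mem s
      root-depth   : depth s ≡ 0
      parent-mem   : ∀ v → mem v → v ≢ s → mem (parent v)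
      parent-edge  : ∀ v → mem v → v ≢ s → Edge (parent v) v
      parent-depth : ∀ v → mem v → v ≢ s → depth v ≡ suc (depth (parent v))
      mem-iff      : ∀ v → mem v ⇔ DistLe s v d
      depth-dist   : ∀ v → mem v → DistEq s v (depth v)

  IsBlocker : ∀ {d s} → SPTree d s → ℕ → (Fin n → Set) → Set
  IsBlocker T d B = ∀ v → SPTree.mem T v → SPTree.depth T v ≡ d →
                    ∃ λ j → j ≤ d × B (iter (SPTree.parent T) j v)

  IsBlockerFamily : ∀ {d} → ((s : Fin n) → SPTree d s) → (Fin n → Set) → Set
  IsBlockerFamily {d} 𝒯 B = ∀ s → IsBlocker (𝒯 s) d B

module Submission where

-- Split a shortest u → v path p longer than 2d as p₁ p₂ p₃ with |p₁| = |p₂| = d.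
-- As an infix of a shortest path, p₂ is a shortest w → x path of length d, so x
-- lies at depth d in T_w; hence some b ∈ B lies on the tree path w → x, which
-- splits it as t r with |t| + |r| = d.  Then p₁ t is a piece of at most 2d
-- edges ending in B, and r p₃ is a strictly shorter b → v walk; replacing it by
-- a covered shortest b → v path (induction) keeps the whole path shortest.

open import Defs
open import Data.Nat using (ℕ; _<_; _*_)
open import Data.Fin using (Fin)

open import Data.Nat using (zero; suc; _+_; _≤_; z≤n; s≤s; _≤?_)
open import Data.Nat.Properties
  using ( ≤-refl; ≤-trans; ≤-reflexive; ≤-antisym; ≤-pred; <-≤-trans; <⇒≤; ≰⇒>
        ; m≤n⇒m≤1+n; n≤1+n; 1+n≰n; m≤m+n; m<n+m; +-identityʳ; +-assoc; +-suc
        ; +-monoʳ-≤; +-cancelˡ-≤; +-cancelʳ-≤ )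
open import Data.Fin using (_≟_)
open import Data.Fin.Properties using (any?)
open import Data.Product using (Σ; ∃; _×_; _,_; proj₁; proj₂)
open import Relation.Nullary using (Dec; yes; no)
open import Relation.Nullary.Decidable using (_×-dec_)
open import Relation.Nullary.Decidable.Core using (T?)
open import Relation.Binary.PropositionalEquality
  using (_≡_; _≢_; refl; sym; trans; cong; cong₂; subst₂; module ≡-Reasoning)
open import Function.Bundles using (Equivalence)

module WalkProperties {n : ℕ} (G : Graph n) where

  infixr 5 _++ʷ_
  _++ʷ_ : ∀ {u w v} → Walk G u w → Walk G w v → Walk G u v
  _++ʷ_ = _++_ G

  len-++ : ∀ {u w v} (p : Walk G u w) (q : Walk G w v) →
           len G (p ++ʷ q) ≡ len G p + len G q
  len-++ []           q = refl
  len-++ (step w e p) q = cong suc (len-++ p q)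

  DistLe? : ∀ k u v → Dec (DistLe G u v k)
  DistLe? k u v with u ≟ v
  DistLe? k u v       | yes refl = yes ([] , z≤n)
  DistLe? zero u v    | no u≢v   = no λ { ([] , _) → u≢v refl ; (step _ _ _ , ()) }
  DistLe? (suc k) u v | no u≢v
    with any? (λ w → T? (G u w) ×-dec DistLe? k w v)
  ... | yes (w , e , p , p≤k) = yes (step w e p , s≤s p≤k)
  ... | no ¬via = no λ { ([] , _) → u≢v refl
                       ; (step w e p , s≤s p≤k) → ¬via (w , e , p , p≤k) }

  shortest-within : ∀ m {u v} → DistLe G u v m →
                    Σ (Walk G u v) λ q → IsShortest G q × len G q ≤ m
  shortest-within zero (p , p≤0) = p , (λ _ → ≤-trans p≤0 z≤n) , p≤0
  shortest-within (suc m) {u} {v} (p , p≤1+m) with DistLe? m u v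
  ... | yes within-m =
          let q , q-sh , q≤m = shortest-within m within-m in q , q-sh , m≤n⇒m≤1+n q≤m
  ... | no ¬within-m = p , (λ q → ≤-trans p≤1+m (≰⇒> λ q≤m → ¬within-m (q , q≤m))) , p≤1+m

  data SplitAt (k : ℕ) {u v : Fin n} : Walk G u v → Set where
    split : ∀ {w} (p₁ : Walk G u w) (p₂ : Walk G w v) → len G p₁ ≡ k →
            SplitAt k (p₁ ++ʷ p₂)

  splitAt : ∀ k {u v} (p : Walk G u v) → k ≤ len G p → SplitAt k p
  splitAt zero    p            _ = split [] p refl
  splitAt (suc k) (step w e p) (s≤s k≤p) with splitAt k p k≤p
  ... | split p₁ p₂ p₁≡k = split (step w e p₁) p₂ (cong suc p₁≡k)

  infix-shortest : ∀ {u w x v} (p₁ : Walk G u w) (p₂ : Walk G w x) (p₃ : Walk G x v) →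
                   IsShortest G (p₁ ++ʷ p₂ ++ʷ p₃) → IsShortest G p₂
  infix-shortest p₁ p₂ p₃ sh q =
    +-cancelʳ-≤ (len G p₃) _ _ (+-cancelˡ-≤ (len G p₁) _ _
      (subst₂ _≤_ (len-++₃ p₂) (len-++₃ q) (sh (p₁ ++ʷ q ++ʷ p₃))))
    where
    len-++₃ : (r : Walk G _ _) → len G (p₁ ++ʷ r ++ʷ p₃) ≡ len G p₁ + (len G r + len G p₃)
    len-++₃ r = trans (len-++ p₁ _) (cong (len G p₁ +_) (len-++ r p₃))

module SPTreeProperties {n : ℕ} {G : Graph n} {d : ℕ} {s : Fin n} (T : SPTree G d s) where
  open WalkProperties G
  open SPTree T

  depth-of-shortest : ∀ {x} (p : Walk G s x) → IsShortest G p → len G p ≤ d →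
                      mem x × depth x ≡ len G p
  depth-of-shortest {x} p p-sh p≤d = x∈T , ≤-antisym (depth≤ p) (≤-trans (p-sh tree-path) tree-path≡)
    where
    x∈T   = Equivalence.from (mem-iff x) (p , p≤d)
    depth≤ = proj₂ (depth-dist x x∈T)
    tree-path  = proj₁ (proj₁ (depth-dist x x∈T))
    tree-path≡ = ≤-reflexive (proj₂ (proj₁ (depth-dist x x∈T)))

  ancestor : ∀ j {y} → mem y → j ≤ depth y →
             mem (iter G parent j y) × depth (iter G parent j y) + j ≡ depth y ×
             Σ (Walk G (iter G parent j y) y) λ r → len G r ≡ j
  ancestor zero    {y} y∈T _ = y∈T , +-identityʳ (depth y) , [] , refl
  ancestor (suc j) {y} y∈T 1+j≤y with ancestor j y∈T (≤-trans (n≤1+n j) 1+j≤y)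
  ... | z∈T , z+j≡y , r , r≡j =
        parent-mem z z∈T z≢s , parent+1+j≡y , step z (parent-edge z z∈T z≢s) r , cong suc r≡j
    where
    z = iter G parent j y
    z≢s : z ≢ s
    z≢s z≡s = 1+n≰n (≤-trans 1+j≤y (≤-reflexive (trans (sym z+j≡y)
                (cong (_+ j) (trans (cong depth z≡s) root-depth)))))
    parent+1+j≡y : depth (parent z) + suc j ≡ depth y
    parent+1+j≡y = trans (+-suc _ j) (trans (cong (_+ j) (sym (parent-depth z z∈T z≢s))) z+j≡y)

  blocker-splits-shortest : ∀ {B x} → IsBlocker G T d B →
                            (p : Walk G s x) → IsShortest G p → len G p ≡ d →
                            ∃ λ b → B b × Σ (Walk G s b) λ t → Σ (Walk G b x) λ r →
                              len G t + len G r ≡ d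
  blocker-splits-shortest blocks p p-sh p≡d
    with depth-of-shortest p p-sh (≤-reflexive p≡d)
  ... | x∈T , x≡p with blocks _ x∈T (trans x≡p p≡d)
  ...   | j , j≤d , b∈B with ancestor j x∈T (≤-trans j≤d (≤-reflexive (sym (trans x≡p p≡d))))
  ...     | b∈T , b+j≡x , r , r≡j =
              _ , b∈B , t , r ,
              trans (cong₂ _+_ t≡b r≡j) (trans b+j≡x (trans x≡p p≡d))
    where
    t   = proj₁ (proj₁ (depth-dist _ b∈T))
    t≡b = proj₂ (proj₁ (depth-dist _ b∈T))

module HubSet {n : ℕ} (G : Graph n) (d : ℕ) (0<d : 0 < d)
              (𝒯 : (s : Fin n) → SPTree G d s) (B : Fin n → Set)
              (blocks : IsBlockerFamily G 𝒯 B) where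
  open WalkProperties G
  open SPTreeProperties using (blocker-splits-shortest)

  reroute-through-blocker : ∀ {u v} (p : Walk G u v) → IsShortest G p → 2 * d ≤ len G p →
                            ∃ λ b → B b × Σ (Walk G u b) λ a → Σ (Walk G b v) λ r →
                              len G a ≤ 2 * d × len G a + len G r ≡ len G p × len G r < len G p
  reroute-through-blocker p p-sh 2d≤p with splitAt d p (≤-trans (m≤m+n d (d + 0)) 2d≤p)
  ... | split p₁ rest p₁≡d with splitAt d rest d≤rest
    where
    d≤rest : d ≤ len G rest
    d≤rest = ≤-trans (≤-reflexive (sym (+-identityʳ d)))
               (+-cancelˡ-≤ d _ _ (≤-trans 2d≤p (≤-reflexive (trans (len-++ p₁ rest)
                                                               (cong (_+ len G rest) p₁≡d)))))
  ...   | split p₂ p₃ p₂≡d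
    with blocker-splits-shortest (𝒯 _) (blocks _) p₂ (infix-shortest p₁ p₂ p₃ p-sh) p₂≡d
  ...     | b , b∈B , t , r , t+r≡d =
              b , b∈B , p₁ ++ʷ t , r ++ʷ p₃ , a≤2d , a+r≡p ,
              <-≤-trans (m<n+m _ (<-≤-trans 0<d d≤a)) (≤-reflexive a+r≡p)
    where
    open ≡-Reasoning
    a≡d+t : len G (p₁ ++ʷ t) ≡ d + len G t
    a≡d+t = trans (len-++ p₁ t) (cong (_+ len G t) p₁≡d)
    d≤a : d ≤ len G (p₁ ++ʷ t)
    d≤a = ≤-trans (m≤m+n d _) (≤-reflexive (sym a≡d+t))
    a≤2d : len G (p₁ ++ʷ t) ≤ 2 * d
    a≤2d = ≤-trans (≤-reflexive a≡d+t)
             (+-monoʳ-≤ d (≤-trans (m≤m+n _ _) (≤-reflexive (trans t+r≡d (sym (+-identityʳ d))))))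
    a+r≡p : len G (p₁ ++ʷ t) + len G (r ++ʷ p₃) ≡ len G (p₁ ++ʷ p₂ ++ʷ p₃)
    a+r≡p = begin
      len G (p₁ ++ʷ t) + len G (r ++ʷ p₃)     ≡⟨ cong₂ _+_ a≡d+t (len-++ r p₃) ⟩
      (d + len G t) + (len G r + len G p₃)    ≡⟨ +-assoc d _ _ ⟩
      d + (len G t + (len G r + len G p₃))    ≡⟨ cong (d +_) (sym (+-assoc (len G t) _ _)) ⟩
      d + ((len G t + len G r) + len G p₃)    ≡⟨ cong (λ k → d + (k + len G p₃)) (trans t+r≡d (sym p₂≡d)) ⟩
      d + (len G p₂ + len G p₃)               ≡⟨ cong₂ _+_ (sym p₁≡d) (sym (len-++ p₂ p₃)) ⟩
      len G p₁ + len G (p₂ ++ʷ p₃)            ≡⟨ sym (len-++ p₁ _) ⟩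
      len G (p₁ ++ʷ p₂ ++ʷ p₃)                ∎

  covered-shortest : ∀ m {u v} (p : Walk G u v) → len G p < m →
                     Σ (Walk G u v) λ q → IsShortest G q × Covered G B (2 * d) q
  covered-shortest (suc m) p p<1+m with shortest-within (len G p) (p , ≤-refl)
  ... | q , q-sh , q≤p with len G q ≤? 2 * d
  ...   | yes q≤2d = q , q-sh , single q q≤2d
  ...   | no q≰2d with reroute-through-blocker q q-sh (<⇒≤ (≰⇒> q≰2d))
  ...     | b , b∈B , a , r , a≤2d , a+r≡q , r<q
    with covered-shortest m r (<-≤-trans r<q (≤-trans q≤p (≤-pred p<1+m)))
  ...       | r′ , r′-sh , r′-covered = a ++ʷ r′ , a++r′-sh , join a r′ a≤2d b∈B r′-covered
    where
    a++r′-sh : IsShortest G (a ++ʷ r′)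
    a++r′-sh w = ≤-trans (≤-reflexive (len-++ a r′))
                   (≤-trans (+-monoʳ-≤ (len G a) (r′-sh r))
                     (≤-trans (≤-reflexive a+r≡q) (q-sh w)))

mainTheorem10 : ∀ {n : ℕ} (G : Graph n) (d : ℕ) → 0 < d →
    (𝒯 : (s : Fin n) → SPTree G d s) → (B : Fin n → Set) →
    IsBlockerFamily G 𝒯 B → IsHubSet G B (2 * d)
mainTheorem10 G d 0<d 𝒯 B blocks u v p =
  HubSet.covered-shortest G d 0<d 𝒯 B blocks (suc (len G p)) p ≤-refl
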